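{- Let $n\ge1$. The map $c\mapsto\tilde{\mathsf{s}}(c)=\mathsf{s}(c)-\mathsf{s}(\hat0)$ embeds $\mathcal{D}(n)$ as a subposet of $\{0,1\}^r$ (componentwise order), with $\tilde{\mathsf{s}}(\hat0)=(0,\dots,0)$ and $\tilde{\mathsf{s}}(\hat1)=(1,\dots,1)$.
   Context: $\beta(n)=b_1\cdots b_k$ is the binary expansion ($b_1=1$ most significant); its principal prefix is $b_1\cdots b_r$, where $b_{r+1}$ is the rightmost $0$ of $\beta(n)$ ($r=0$ if none). A hyperbinary expansion of $n$ is a word $d_1\cdots d_k$ over $\{0,1,2\}$ with $\sum_i d_i2^{k-i}=n$, corresponding to the hyperbinary partition (parts powers of $2$, each at most twice) in which $2^{k-i}$ has multiplicity $d_i$; $\mathcal{D}(n)$ is the set of these ordered by transporting refinement of partitions ($\mu\le\lambda$ if the parts of $\lambda$ can be subdivided to produce the parts of $\mu$). $\mathcal{D}(n)$ has a minimum $\hat0$ and a maximum $\hat1$ (the binary expansion of $n$). $s_j(c)=\sum_{i=1}^jc_i2^{j-i}$, $\mathsf{s}(c)=(s_1(c),\dots,s_r(c))$, and subtraction is componentwise. -}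

module Defs where

open import Data.Nat using (ℕ; zero; suc; _+_; _*_; _^_; _≤_; _/_; _%_; _≟_)
open import Data.List using (List; []; _∷_; length; reverse; replicate; _++_; take; map; filter; allFin; lookup)
open import Data.List.Relation.Unary.All using (All)
open import Data.Nat.ListAction using (sum)
open import Data.Maybe using (Maybe; just; nothing; fromMaybe)
open import Data.Fin using (Fin; toℕ) renaming (_≟_ to _≟ᶠ_)
open import Data.Product using (Σ; _×_)
open import Data.Integer as ℤ using (ℤ; +_)
open import Relation.Binary.PropositionalEquality using (_≡_)
open import Relation.Nullary using (yes; no)

-- Binary digits, least significant first (fuel argument guarantees termination;
-- fuel n suffices for n).
bitsLSB : ℕ → ℕ → List ℕ
bitsLSB zero    _ = []
bitsLSB (suc f) zero = []
bitsLSB (suc f) (suc m) = (suc m % 2) ∷ bitsLSB f (suc m / 2)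

β : ℕ → List ℕ
β n = reverse (bitsLSB n n)

len : ℕ → ℕ
len n = length (β n)

-- 0-based index of the rightmost 0 in a word, if any.
lastZero : List ℕ → Maybe ℕ
lastZero [] = nothing
lastZero (b ∷ bs) with lastZero bs
... | just i  = just (suc i)
... | nothing with b ≟ 0
...   | yes _ = just 0
...   | no  _ = nothing

-- r = length of the principal prefix: b_{r+1} is the rightmost 0 (r = 0 if none).
r : ℕ → ℕ
r n = fromMaybe 0 (lastZero (β n))

val : List ℕ → ℕ
val = go 0
  where
  go : ℕ → List ℕ → ℕ
  go acc [] = acc
  go acc (d ∷ ds) = go (2 * acc + d) ds

s : ℕ → List ℕ → ℕ
s j c = val (take j c)

IsHB : ℕ → List ℕ → Set
IsHB n c = (length c ≡ len n) × All (_≤ 2) c × (val c ≡ n)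

HB : ℕ → Set
HB n = Σ (List ℕ) (IsHB n)

parts : List ℕ → List ℕ
parts [] = []
parts (d ∷ ds) = replicate d (2 ^ length ds) ++ parts ds

-- Refinement of partitions: μ ≼ λ iff the parts of λ can be subdivided to
-- produce the parts of μ, i.e. there is an assignment f of the parts of μ to
-- the parts of λ such that the parts of μ assigned to each part λ_j sum to λ_j.
_≼_ : List ℕ → List ℕ → Set
μ ≼ λ' = Σ (Fin (length μ) → Fin (length λ')) λ f →
  (j : Fin (length λ')) →
  sum (map (lookup μ) (filter (λ i → f i ≟ᶠ j) (allFin (length μ)))) ≡ lookup λ' j

_≤D_ : {n : ℕ} → HB n → HB n → Set
c ≤D c' = parts (Σ.proj₁ c) ≼ parts (Σ.proj₁ c')

IsMinimum : {n : ℕ} → HB n → Set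
IsMinimum {n} z = (c : HB n) → z ≤D c

-- s̃(c)_j = s_j(c) - s_j(z), for j = 1..r (index j : Fin r stands for j+1).
s̃ : {n : ℕ} → HB n → HB n → Fin (r n) → ℤ
s̃ z c j = (+ s (suc (toℕ j)) (Σ.proj₁ c)) ℤ.- (+ s (suc (toℕ j)) (Σ.proj₁ z))

-- Split a hyperbinary expansion c of n and the binary expansion β(n) (words of the same length k)
-- after position j: s_j(c)·2^(k-j) + (rest of c) = n = s_j(β(n))·2^(k-j) + (rest of β(n)).  The rest
-- of β(n) is below 2^(k-j), the rest of c at most 2·(2^(k-j) - 1), so s_j(c) ≤ s_j(β(n)) ≤ s_j(c) + 1,
-- with equality when the rest of β(n) consists of 1s, i.e. for j > r.
-- The order of 𝒟(n) is the componentwise order of all prefix values s_j: the sum of ⌊p / 2^e⌋ over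
-- the parts p of c is s_(k-e)(c), and it cannot grow under refinement because ⌊· / 2^e⌋ is
-- superadditive; conversely, if c is dominated by c′, pass the excess of the leading digit of c′ to
-- the next digit (splitting parts 2N into N + N) and recurse.
-- Writing β(n) = 1 w 0 u with u all 1s and r = |1w|, the word 0 (w+1) 2 u has s_j = s_j(β(n)) - 1 for
-- 1 ≤ j ≤ r, so it is the minimum; every minimum has these prefix values, which confines s̃ to {0,1}^r.
module Submission where

open import Defs
open import Data.Nat using (ℕ; _≤_)
open import Data.List using (List)
open import Data.Fin using (Fin)
open import Data.Integer using (ℤ; 0ℤ; 1ℤ) renaming (_≤_ to _≤ℤ_)
open import Data.Product using (Σ; _×_; proj₁; ∃)
open import Data.Sum using (_⊎_)
open import Function.Bundles using (_⇔_)
open import Relation.Binary.PropositionalEquality using (_≡_)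

open import Data.Bool using (true; false; if_then_else_)
open import Data.Empty using (⊥-elim)
open import Data.Fin using (zero; suc; toℕ; fromℕ<) renaming (_≟_ to _≟ᶠ_)
open import Data.Fin.Properties using (toℕ<n; toℕ-fromℕ<)
open import Data.Integer as ℤ using (_-_; +≤+)
import Data.Integer.Properties as ℤₚ
open import Data.List using ([]; _∷_; _++_; _∷ʳ_; length; take; drop; map; replicate; reverse; lookup; filter; tabulate; allFin)
open import Data.List.Properties
  using (length-++; length-map; length-take; length-drop; take++drop≡id; take-all; take-map; drop-drop; map-++; ++-assoc; unfold-reverse; reverse-++)
open import Data.List.Relation.Unary.All as All using (All; []; _∷_)
import Data.List.Relation.Unary.All.Properties as Allₚ
open import Data.Maybe using (just; nothing; fromMaybe)
open import Data.Maybe.Properties using (just-injective)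
open import Data.Nat using (NonZero; zero; suc; _+_; _*_; _^_; _∸_; _<_; _⊓_; z≤n; s≤s; s≤s⁻¹)
open import Data.Nat.DivMod using (_/_; _%_; m≡m%n+[m/n]*n; m%n<n; m/n<m; m≥n⇒m/n>0; 0/n≡0; m*n/n≡m; m/n*n≤m; /-monoˡ-≤; m<n⇒m/n≡0)
open import Data.Nat.ListAction using (sum)
open import Data.Nat.ListAction.Properties using (sum-++)
open import Data.Nat.Properties
open import Data.Nat.Solver using (module +-*-Solver)
open import Algebra.Properties.CommutativeMonoid.Sum +-0-commutativeMonoid
  using (sum-syntax; ∑-comm; sum-cong-≗; sum-replicate-zero)
open import Data.Product using (_,_; ∃₂)
open import Data.Sum as Sum using (inj₁; inj₂)
open import Function using (_∘_; id)
open import Function.Bundles using (mk⇔)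
open import Relation.Binary.PropositionalEquality
  using (_≢_; refl; sym; trans; cong; cong₂; subst; subst₂; module ≡-Reasoning)
open import Relation.Nullary using (does; yes; no)
open import Relation.Unary using (Decidable)

open +-*-Solver

-- Horner values of digit words

value : List ℕ → ℕ
value []       = 0
value (d ∷ ds) = d * 2 ^ length ds + value ds

prefix : ℕ → List ℕ → ℕ
prefix j c = value (take j c)

-- `val` is a left fold: val (d ∷ d′ ∷ ds) reduces to val ((2 * d + d′) ∷ ds).
val-∷ : ∀ d ds → val (d ∷ ds) ≡ value (d ∷ ds)
val-∷ d []        = sym (trans (+-identityʳ _) (*-identityʳ d))
val-∷ d (d′ ∷ ds) = trans (val-∷ (2 * d + d′) ds)
  (solve 4 (λ d d′ p v → (con 2 :* d :+ d′) :* p :+ v := d :* (con 2 :* p) :+ (d′ :* p :+ v))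
         refl d d′ (2 ^ length ds) (value ds))

val≡value : ∀ ds → val ds ≡ value ds
val≡value []       = refl
val≡value (d ∷ ds) = val-∷ d ds

s≡prefix : ∀ j c → s j c ≡ prefix j c
s≡prefix j c = val≡value (take j c)

value-++ : ∀ xs ys → value (xs ++ ys) ≡ value xs * 2 ^ length ys + value ys
value-++ []       ys = refl
value-++ (x ∷ xs) ys = begin
    x * 2 ^ length (xs ++ ys) + value (xs ++ ys)
  ≡⟨ cong₂ (λ l v → x * 2 ^ l + v) (length-++ xs) (value-++ xs ys) ⟩
    x * 2 ^ (length xs + length ys) + (value xs * 2 ^ length ys + value ys)
  ≡⟨ cong (λ p → x * p + (value xs * 2 ^ length ys + value ys)) (^-distribˡ-+-* 2 (length xs) (length ys)) ⟩
    x * (2 ^ length xs * 2 ^ length ys) + (value xs * 2 ^ length ys + value ys)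
  ≡⟨ solve 5 (λ x p q v w → x :* (p :* q) :+ (v :* q :+ w) := (x :* p :+ v) :* q :+ w)
           refl x (2 ^ length xs) (2 ^ length ys) (value xs) (value ys) ⟩
    (x * 2 ^ length xs + value xs) * 2 ^ length ys + value ys
  ∎
  where open ≡-Reasoning

value-take-drop : ∀ j c → value c ≡ prefix j c * 2 ^ length (drop j c) + value (drop j c)
value-take-drop j c = trans (cong value (sym (take++drop≡id j c))) (value-++ (take j c) (drop j c))

value-bounded : ∀ b {ds} → All (_≤ b) ds → b + value ds ≤ b * 2 ^ length ds
value-bounded b {[]}     []         = ≤-reflexive (trans (+-identityʳ b) (sym (*-identityʳ b)))
value-bounded b {d ∷ ds} (d≤b ∷ ds≤b) = begin
    b + (d * P + value ds)     ≡⟨ solve 4 (λ b d p v → b :+ (d :* p :+ v) := d :* p :+ (b :+ v)) refl b d P (value ds) ⟩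
    d * P + (b + value ds)     ≤⟨ +-mono-≤ (*-monoˡ-≤ P d≤b) (value-bounded b ds≤b) ⟩
    b * P + b * P              ≡⟨ solve 2 (λ b p → b :* p :+ b :* p := b :* (con 2 :* p)) refl b P ⟩
    b * (2 * P)                ∎
  where
  open ≤-Reasoning
  P = 2 ^ length ds

value-ones : ∀ {ds} → All (_≡ 1) ds → suc (value ds) ≡ 2 ^ length ds
value-ones {[]}     []          = refl
value-ones {_ ∷ ds} (refl ∷ ones) = begin
    suc (1 * P + value ds)   ≡⟨ solve 2 (λ p v → con 1 :+ (con 1 :* p :+ v) := p :+ (con 1 :+ v)) refl P (value ds) ⟩
    P + suc (value ds)       ≡⟨ cong (P +_) (value-ones ones) ⟩
    P + P                    ≡⟨ cong (P +_) (sym (+-identityʳ P)) ⟩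
    2 * P                    ∎
  where
  open ≡-Reasoning
  P = 2 ^ length ds

length-take-≡ : ∀ j {xs ys : List ℕ} → length xs ≡ length ys → length (take j xs) ≡ length (take j ys)
length-take-≡ j {xs} {ys} eq = trans (length-take j xs) (trans (cong (j ⊓_) eq) (sym (length-take j ys)))

length-drop-≡ : ∀ j {xs ys : List ℕ} → length xs ≡ length ys → length (drop j xs) ≡ length (drop j ys)
length-drop-≡ j {xs} {ys} eq = trans (length-drop j xs) (trans (cong (_∸ j) eq) (sym (length-drop j ys)))

prefix-1 : ∀ d ds → prefix 1 (d ∷ ds) ≡ d
prefix-1 d ds = trans (+-identityʳ _) (*-identityʳ d)

prefix-injective : ∀ {c c′} → length c ≡ length c′ → (∀ j → prefix j c ≡ prefix j c′) → c ≡ c′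
prefix-injective {[]}     {[]}       _   _  = refl
prefix-injective {d ∷ ds} {d′ ∷ ds′} eq p≡ = cong₂ _∷_ d≡d′ (prefix-injective |ds|≡|ds′| tail≡)
  where
  |ds|≡|ds′| = suc-injective eq
  d≡d′ : d ≡ d′
  d≡d′ = trans (sym (prefix-1 d ds)) (trans (p≡ 1) (prefix-1 d′ ds′))
  tail≡ : ∀ j → prefix j ds ≡ prefix j ds′
  tail≡ j = +-cancelˡ-≡ (d * 2 ^ length (take j ds)) _ _
    (trans (p≡ (suc j))
           (cong₂ (λ x l → x * 2 ^ l + prefix j ds′) (sym d≡d′) (sym (length-take-≡ j |ds|≡|ds′|))))

-- Prefix values against a binary word of the same length and value

quotient-bound : ∀ {a b t P x y} → a * P + x ≡ b * P + y → y < t * P + x → a < t + b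
quotient-bound {a} {b} {t} {P} {x} {y} eq y< = ≰⇒> λ t+b≤a → <⇒≱ y< (+-cancelˡ-≤ (b * P) _ _ (begin
    b * P + (t * P + x)   ≡⟨ solve 4 (λ b t p x → b :* p :+ (t :* p :+ x) := (t :+ b) :* p :+ x) refl b t P x ⟩
    (t + b) * P + x       ≤⟨ +-monoˡ-≤ x (*-monoˡ-≤ P t+b≤a) ⟩
    a * P + x             ≡⟨ eq ⟩
    b * P + y             ∎))
  where open ≤-Reasoning

module _ {u v : List ℕ} (|u|≡|v| : length u ≡ length v) (u≈v : value u ≡ value v)
         (u≤1 : All (_≤ 1) u) (v≤2 : All (_≤ 2) v) where

  private
    P : ℕ → ℕ
    P j = 2 ^ length (drop j v)

    split : ∀ j → prefix j u * P j + value (drop j u) ≡ prefix j v * P j + value (drop j v)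
    split j = begin
        prefix j u * P j + value (drop j u)
      ≡⟨ cong (λ l → prefix j u * 2 ^ l + value (drop j u)) (sym (length-drop-≡ j |u|≡|v|)) ⟩
        prefix j u * 2 ^ length (drop j u) + value (drop j u)
      ≡⟨ sym (value-take-drop j u) ⟩
        value u
      ≡⟨ u≈v ⟩
        value v
      ≡⟨ value-take-drop j v ⟩
        prefix j v * P j + value (drop j v)
      ∎
      where open ≡-Reasoning

    tail-u< : ∀ j → value (drop j u) < 1 * P j
    tail-u< j = subst (λ l → value (drop j u) < 1 * 2 ^ l) (length-drop-≡ j |u|≡|v|)
                      (value-bounded 1 (Allₚ.drop⁺ j u≤1))

    tail-v-bound : ∀ j → 2 + value (drop j v) ≤ 2 * P j
    tail-v-bound j = value-bounded 2 (Allₚ.drop⁺ j v≤2)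

  binary-prefix-≥ : ∀ j → prefix j v ≤ prefix j u
  binary-prefix-≥ j = s≤s⁻¹ (quotient-bound {t = 1} (sym (split j)) (≤-trans (tail-u< j) (m≤m+n _ _)))

  binary-prefix-≤suc : ∀ j → prefix j u ≤ suc (prefix j v)
  binary-prefix-≤suc j =
    s≤s⁻¹ (quotient-bound {t = 2} (split j) (≤-trans (n≤1+n _) (≤-trans (tail-v-bound j) (m≤m+n _ _))))

  binary-prefix-≡ : ∀ j → All (_≡ 1) (drop j u) → prefix j u ≡ prefix j v
  binary-prefix-≡ j ones = ≤-antisym (s≤s⁻¹ (quotient-bound {t = 1} (split j) y<)) (binary-prefix-≥ j)
    where
    x = value (drop j u)
    y = value (drop j v)
    P≡ : P j ≡ suc x
    P≡ = trans (cong (2 ^_) (sym (length-drop-≡ j |u|≡|v|))) (sym (value-ones ones))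
    2P≡ : 2 * P j ≡ suc (1 * P j + x)
    2P≡ = begin
        2 * P j             ≡⟨ solve 1 (λ p → con 2 :* p := con 1 :* p :+ p) refl (P j) ⟩
        1 * P j + P j       ≡⟨ cong (1 * P j +_) P≡ ⟩
        1 * P j + suc x     ≡⟨ +-suc (1 * P j) x ⟩
        suc (1 * P j + x)   ∎
      where open ≡-Reasoning
    y< : y < 1 * P j + x
    y< = s≤s⁻¹ (≤-trans (tail-v-bound j) (≤-reflexive 2P≡))

-- The binary expansion

value-∷ʳ : ∀ xs d → value (xs ∷ʳ d) ≡ value xs * 2 + d
value-∷ʳ xs d = trans (value-++ xs (d ∷ [])) (cong (value xs * 2 +_) (prefix-1 d []))

half-≤ : ∀ m → suc m / 2 ≤ m
half-≤ m = <⇒≤pred (m/n<m (suc m) 2 (s≤s (s≤s z≤n)))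

value-bitsLSB : ∀ f m → m ≤ f → value (reverse (bitsLSB f m)) ≡ m
value-bitsLSB zero    zero    _         = refl
value-bitsLSB (suc f) zero    _         = refl
value-bitsLSB (suc f) (suc m) (s≤s m≤f) = begin
    value (reverse (suc m % 2 ∷ bitsLSB f (suc m / 2)))
  ≡⟨ cong value (unfold-reverse (suc m % 2) (bitsLSB f (suc m / 2))) ⟩
    value (reverse (bitsLSB f (suc m / 2)) ∷ʳ suc m % 2)
  ≡⟨ value-∷ʳ (reverse (bitsLSB f (suc m / 2))) (suc m % 2) ⟩
    value (reverse (bitsLSB f (suc m / 2))) * 2 + suc m % 2
  ≡⟨ cong (λ v → v * 2 + suc m % 2) (value-bitsLSB f (suc m / 2) (≤-trans (half-≤ m) m≤f)) ⟩
    suc m / 2 * 2 + suc m % 2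
  ≡⟨ +-comm (suc m / 2 * 2) (suc m % 2) ⟩
    suc m % 2 + suc m / 2 * 2
  ≡⟨ sym (m≡m%n+[m/n]*n (suc m) 2) ⟩
    suc m
  ∎
  where open ≡-Reasoning

value-β : ∀ n → value (β n) ≡ n
value-β n = value-bitsLSB n n ≤-refl

All-reverse : ∀ {P : ℕ → Set} {xs} → All P xs → All P (reverse xs)
All-reverse []                      = []
All-reverse {xs = x ∷ xs} (px ∷ pxs) =
  subst (All _) (sym (unfold-reverse x xs)) (Allₚ.∷ʳ⁺ (All-reverse pxs) px)

bitsLSB-binary : ∀ f m → All (_≤ 1) (bitsLSB f m)
bitsLSB-binary zero    m       = []
bitsLSB-binary (suc f) zero    = []
bitsLSB-binary (suc f) (suc m) = <⇒≤pred (m%n<n (suc m) 2) ∷ bitsLSB-binary f (suc m / 2)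

β-binary : ∀ n → All (_≤ 1) (β n)
β-binary n = All-reverse (bitsLSB-binary n n)

bitsLSB-last : ∀ f m → 1 ≤ m → m ≤ f → ∃ λ xs → bitsLSB f m ≡ xs ∷ʳ 1
bitsLSB-last (suc zero)    (suc zero)    _ _         = [] , refl
bitsLSB-last (suc (suc f)) (suc zero)    _ _         = [] , refl
bitsLSB-last (suc f)       (suc (suc m)) _ (s≤s m≤f)
  with bitsLSB-last f (suc (suc m) / 2) (m≥n⇒m/n>0 {suc (suc m)} {2} (s≤s (s≤s z≤n)))
                      (≤-trans (half-≤ (suc m)) m≤f)
... | xs , eq = (suc (suc m) % 2 ∷ xs) , cong (suc (suc m) % 2 ∷_) eq

β-leading-one : ∀ {n} → 1 ≤ n → ∃ λ t → β n ≡ 1 ∷ t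
β-leading-one {n} 1≤n with bitsLSB-last n n 1≤n ≤-refl
... | xs , eq = reverse xs , trans (cong reverse eq) (reverse-++ xs (1 ∷ []))

lastZero-nothing : ∀ {l} → lastZero l ≡ nothing → All (_≢ 0) l
lastZero-nothing {[]}     _  = []
lastZero-nothing {b ∷ bs} eq with lastZero bs in eq'
lastZero-nothing {b ∷ bs} () | just _
... | nothing with b ≟ 0
...   | no b≢0 = b≢0 ∷ lastZero-nothing eq'

lastZero-just : ∀ {l i} → lastZero l ≡ just i →
  ∃₂ λ pre post → l ≡ pre ++ 0 ∷ post × length pre ≡ i × All (_≢ 0) post
lastZero-just {b ∷ bs} eq with lastZero bs in eq'
... | just i with lastZero-just {bs} eq'
...   | pre , post , refl , refl , post≢0 = b ∷ pre , post , refl , just-injective eq , post≢0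
lastZero-just {b ∷ bs} eq | nothing with b ≟ 0
...   | yes refl = [] , bs , refl , just-injective eq , lastZero-nothing eq'
lastZero-just {b ∷ bs} () | nothing | no _

≤1∧≢0⇒≡1 : ∀ {x} → x ≤ 1 → x ≢ 0 → x ≡ 1
≤1∧≢0⇒≡1 z≤n       x≢0 = ⊥-elim (x≢0 refl)
≤1∧≢0⇒≡1 (s≤s z≤n) _   = refl

binary-nonzero⇒ones : ∀ {l} → All (_≤ 1) l → All (_≢ 0) l → All (_≡ 1) l
binary-nonzero⇒ones l≤1 l≢0 = All.zipWith (λ (x≤1 , x≢0) → ≤1∧≢0⇒≡1 x≤1 x≢0) (l≤1 , l≢0)

drop-++-∷ : ∀ (pre : List ℕ) x post → drop (suc (length pre)) (pre ++ x ∷ post) ≡ post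
drop-++-∷ []        x post = refl
drop-++-∷ (_ ∷ pre) x post = drop-++-∷ pre x post

drop⁺-≤ : ∀ {P : ℕ → Set} {m j} xs → m ≤ j → All P (drop m xs) → All P (drop j xs)
drop⁺-≤ {m = m} {j} xs m≤j p =
  subst (All _) (trans (drop-drop m (j ∸ m) xs) (cong (λ k → drop k xs) (m+[n∸m]≡n m≤j)))
        (Allₚ.drop⁺ (j ∸ m) p)

ones-after-lastZero : ∀ {u} → All (_≤ 1) u → ∀ m → lastZero u ≡ m →
  All (_≡ 1) (drop (suc (fromMaybe 0 m)) u)
ones-after-lastZero u≤1 nothing  eq = Allₚ.drop⁺ 1 (binary-nonzero⇒ones u≤1 (lastZero-nothing eq))
ones-after-lastZero {u} u≤1 (just i) eq with lastZero-just {u} eq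
... | pre , post , refl , refl , post≢0 with Allₚ.++⁻ʳ pre u≤1
...   | _ ∷ post≤1 = subst (All (_≡ 1)) (sym (drop-++-∷ pre 0 post)) (binary-nonzero⇒ones post≤1 post≢0)

β-ones-after-r : ∀ n → All (_≡ 1) (drop (suc (r n)) (β n))
β-ones-after-r n = ones-after-lastZero (β-binary n) (lastZero (β n)) refl

-- Refinement, fibre sums and block decompositions

ifEq : ∀ {b} → Fin b → Fin b → ℕ → ℕ
ifEq t j x = if does (t ≟ᶠ j) then x else 0

∑-ifEq : ∀ {b} (t : Fin b) x → ∑[ j < b ] ifEq t j x ≡ x
∑-ifEq {suc b} zero    x = trans (cong (x +_) (sum-replicate-zero b)) (+-identityʳ x)
∑-ifEq         (suc t) x = ∑-ifEq t x

ifEq-commute : ∀ {b} (g : ℕ → ℕ) → g 0 ≡ 0 → (t j : Fin b) (x : ℕ) → ifEq t j (g x) ≡ g (ifEq t j x)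
ifEq-commute g g0 t j x with does (t ≟ᶠ j)
... | true  = refl
... | false = sym g0

∑-mono-≤ : ∀ {m} {f g : Fin m → ℕ} → (∀ i → f i ≤ g i) → ∑[ i < m ] f i ≤ ∑[ i < m ] g i
∑-mono-≤ {zero}  _   = z≤n
∑-mono-≤ {suc m} f≤g = +-mono-≤ (f≤g zero) (∑-mono-≤ (f≤g ∘ suc))

Superadditive : (ℕ → ℕ) → Set
Superadditive g = ∀ a b → g a + g b ≤ g (a + b)

∑-superadditive : ∀ g → g 0 ≡ 0 → Superadditive g → ∀ {m} (h : Fin m → ℕ) →
  ∑[ i < m ] g (h i) ≤ g (∑[ i < m ] h i)
∑-superadditive g g0 _   {zero}  h = ≤-reflexive (sym g0)
∑-superadditive g g0 sup {suc m} h =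
  ≤-trans (+-monoʳ-≤ _ (∑-superadditive g g0 sup (h ∘ suc))) (sup (h zero) _)

sum-map-lookup : ∀ (g : ℕ → ℕ) μ → sum (map g μ) ≡ ∑[ i < length μ ] g (lookup μ i)
sum-map-lookup g []      = refl
sum-map-lookup g (x ∷ μ) = cong (g x +_) (sum-map-lookup g μ)

sum-filter-tabulate : ∀ {A : Set} {P : A → Set} (P? : Decidable P) (h : A → ℕ) {m} (e : Fin m → A) →
  sum (map h (filter P? (tabulate e))) ≡ ∑[ i < m ] (if does (P? (e i)) then h (e i) else 0)
sum-filter-tabulate P? h {zero}  e = refl
sum-filter-tabulate P? h {suc m} e with does (P? (e zero))
... | true  = cong (h (e zero) +_) (sum-filter-tabulate P? h (e ∘ suc))
... | false = sum-filter-tabulate P? h (e ∘ suc)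

fibre-sum : ∀ μ {b} (f : Fin (length μ) → Fin b) j →
  sum (map (lookup μ) (filter (λ i → f i ≟ᶠ j) (allFin (length μ))))
    ≡ ∑[ i < length μ ] ifEq (f i) j (lookup μ i)
fibre-sum μ f j = sum-filter-tabulate (λ i → f i ≟ᶠ j) (lookup μ) id

≼⇒sum-map-≤ : ∀ g → g 0 ≡ 0 → Superadditive g → ∀ {μ ν} → μ ≼ ν → sum (map g μ) ≤ sum (map g ν)
≼⇒sum-map-≤ g g0 sup {μ} {ν} (f , fibres) = begin
    sum (map g μ)
  ≡⟨ sum-map-lookup g μ ⟩
    ∑[ i < m ] g (lookup μ i)
  ≡⟨ sum-cong-≗ (λ i → sym (∑-ifEq (f i) _)) ⟩
    ∑[ i < m ] ∑[ j < b ] ifEq (f i) j (g (lookup μ i))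
  ≡⟨ ∑-comm (λ i j → ifEq (f i) j (g (lookup μ i))) ⟩
    ∑[ j < b ] ∑[ i < m ] ifEq (f i) j (g (lookup μ i))
  ≡⟨ sum-cong-≗ (λ j → sum-cong-≗ (λ i → ifEq-commute g g0 (f i) j _)) ⟩
    ∑[ j < b ] ∑[ i < m ] g (ifEq (f i) j (lookup μ i))
  ≤⟨ ∑-mono-≤ (λ j → ∑-superadditive g g0 sup (λ i → ifEq (f i) j (lookup μ i))) ⟩
    ∑[ j < b ] g (∑[ i < m ] ifEq (f i) j (lookup μ i))
  ≡⟨ sum-cong-≗ (λ j → cong g (trans (sym (fibre-sum μ f j)) (fibres j))) ⟩
    ∑[ j < b ] g (lookup ν j)
  ≡⟨ sym (sum-map-lookup g ν) ⟩
    sum (map g ν)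
  ∎
  where
  open ≤-Reasoning
  m = length μ
  b = length ν

record Assignment (μ ν : List ℕ) : Set where
  constructor _,_
  field
    target : Fin (length μ) → Fin (length ν)
    fibres : ∀ j → ∑[ i < length μ ] ifEq (target i) j (lookup μ i) ≡ lookup ν j

Assignment⇒≼ : ∀ {μ ν} → Assignment μ ν → μ ≼ ν
Assignment⇒≼ {μ} (f , fibres) = f , λ j → trans (fibre-sum μ f j) (fibres j)

assignment-open : ∀ {μ ν} → Assignment μ ν → Assignment μ (0 ∷ ν)
assignment-open {μ} (f , fibres) = suc ∘ f , λ where
  zero    → sum-replicate-zero (length μ)
  (suc j) → fibres j

assignment-add : ∀ y {μ x ν} → Assignment μ (x ∷ ν) → Assignment (y ∷ μ) (y + x ∷ ν)
assignment-add y (f , fibres) = (λ { zero → zero ; (suc i) → f i }) , λ where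
  zero    → cong (y +_) (fibres zero)
  (suc j) → fibres (suc j)

data Blocks : List ℕ → List ℕ → Set where
  []    : Blocks [] []
  block : ∀ α {μ ν x} → sum α ≡ x → Blocks μ ν → Blocks (α ++ μ) (x ∷ ν)

Blocks⇒Assignment : ∀ {μ ν} → Blocks μ ν → Assignment μ ν
Blocks⇒Assignment []                          = (λ ()) , (λ ())
Blocks⇒Assignment (block α {μ} {ν} refl bs) = prepend α
  where
  prepend : ∀ α → Assignment (α ++ μ) (sum α ∷ ν)
  prepend []      = assignment-open (Blocks⇒Assignment bs)
  prepend (y ∷ α) = assignment-add y (prepend α)

Blocks⇒≼ : ∀ {μ ν} → Blocks μ ν → μ ≼ ν
Blocks⇒≼ = Assignment⇒≼ ∘ Blocks⇒Assignment

Blocks-∷ : ∀ x {μ ν} → Blocks μ ν → Blocks (x ∷ μ) (x ∷ ν)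
Blocks-∷ x = block (x ∷ []) (+-identityʳ x)

Blocks-refl : ∀ μ → Blocks μ μ
Blocks-refl []      = []
Blocks-refl (x ∷ μ) = Blocks-∷ x (Blocks-refl μ)

Blocks-replicate-++ : ∀ d x {μ ν} → Blocks μ ν → Blocks (replicate d x ++ μ) (replicate d x ++ ν)
Blocks-replicate-++ zero    x bs = bs
Blocks-replicate-++ (suc d) x bs = Blocks-∷ x (Blocks-replicate-++ d x bs)

Blocks-sum : ∀ {μ ν} → Blocks μ ν → sum μ ≡ sum ν
Blocks-sum []                    = refl
Blocks-sum (block α {μ} α≡x bs) = trans (sum-++ α μ) (cong₂ _+_ α≡x (Blocks-sum bs))

Blocks-split : ∀ ν₁ {ν₂ μ} → Blocks μ (ν₁ ++ ν₂) →
  ∃₂ λ μ₁ μ₂ → μ ≡ μ₁ ++ μ₂ × Blocks μ₁ ν₁ × Blocks μ₂ ν₂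
Blocks-split []        {μ = μ} bs = [] , μ , refl , [] , bs
Blocks-split (_ ∷ ν₁) (block α α≡x bs) with Blocks-split ν₁ bs
... | μ₁ , μ₂ , refl , bs₁ , bs₂ = α ++ μ₁ , μ₂ , sym (++-assoc α μ₁ μ₂) , block α α≡x bs₁ , bs₂

Blocks-trans : ∀ {μ ν ξ} → Blocks μ ν → Blocks ν ξ → Blocks μ ξ
Blocks-trans bs []                  = bs
Blocks-trans bs (block α α≡x bs′) with Blocks-split α bs
... | μ₁ , μ₂ , refl , bs₁ , bs₂ = block μ₁ (trans (Blocks-sum bs₁) α≡x) (Blocks-trans bs₂ bs′)

Blocks-parts-∷ : ∀ d xs ys → length xs ≡ length ys → Blocks (parts xs) (parts ys) →
  Blocks (parts (d ∷ xs)) (parts (d ∷ ys))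
Blocks-parts-∷ d xs ys |xs|≡|ys| bs rewrite |xs|≡|ys| = Blocks-replicate-++ d _ bs

Blocks-carry : ∀ d e h N pt →
  Blocks (replicate d (2 * N) ++ replicate (2 * e + h) N ++ pt)
         (replicate (d + e) (2 * N) ++ replicate h N ++ pt)
Blocks-carry (suc d) e       h N pt = Blocks-∷ (2 * N) (Blocks-carry d e h N pt)
Blocks-carry zero    zero    h N pt = Blocks-refl _
Blocks-carry zero    (suc e) h N pt =
  subst (λ k → Blocks (replicate k N ++ pt) (replicate (suc e) (2 * N) ++ replicate h N ++ pt))
        (sym (cong (_+ h) (*-suc 2 e)))
        (block (N ∷ N ∷ []) refl (Blocks-carry zero e h N pt))

parts-carry : ∀ d e h t → Blocks (parts (d ∷ (2 * e + h) ∷ t)) (parts ((d + e) ∷ h ∷ t))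
parts-carry d e h t = Blocks-carry d e h (2 ^ length t) (parts t)

-- Prefix values characterise refinement

infixl 7 _/2^_

_/2^_ : ℕ → ℕ → ℕ
x /2^ e = _/_ x (2 ^ e) {{m^n≢0 2 e}}

0/2^ : ∀ e → 0 /2^ e ≡ 0
0/2^ e = 0/n≡0 (2 ^ e) {{m^n≢0 2 e}}

/-superadditive : ∀ P .{{_ : NonZero P}} → Superadditive (_/ P)
/-superadditive P a b = begin
    a / P + b / P                ≡⟨ sym (m*n/n≡m (a / P + b / P) P) ⟩
    (a / P + b / P) * P / P      ≤⟨ /-monoˡ-≤ P (begin
        (a / P + b / P) * P        ≡⟨ *-distribʳ-+ P (a / P) (b / P) ⟩
        a / P * P + b / P * P      ≤⟨ +-mono-≤ (m/n*n≤m a P) (m/n*n≤m b P) ⟩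
        a + b                      ∎) ⟩
    (a + b) / P                  ∎
  where open ≤-Reasoning

2^/2^ : ∀ {e L} → e ≤ L → 2 ^ L /2^ e ≡ 2 ^ (L ∸ e)
2^/2^ {e} {L} e≤L = begin
    2 ^ L /2^ e                  ≡⟨ cong (_/2^ e) (cong (2 ^_) (sym (m∸n+n≡m e≤L))) ⟩
    2 ^ (L ∸ e + e) /2^ e        ≡⟨ cong (_/2^ e) (^-distribˡ-+-* 2 (L ∸ e) e) ⟩
    2 ^ (L ∸ e) * 2 ^ e /2^ e    ≡⟨ m*n/n≡m (2 ^ (L ∸ e)) (2 ^ e) {{m^n≢0 2 e}} ⟩
    2 ^ (L ∸ e)                  ∎
  where open ≡-Reasoning

2^/2^-< : ∀ {e L} → L < e → 2 ^ L /2^ e ≡ 0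
2^/2^-< {e} L<e = m<n⇒m/n≡0 {{m^n≢0 2 e}} (^-monoʳ-< 2 (s≤s (s≤s z≤n)) L<e)

sum-map-replicate : ∀ (g : ℕ → ℕ) d x → sum (map g (replicate d x)) ≡ d * g x
sum-map-replicate g zero    x = refl
sum-map-replicate g (suc d) x = cong (g x +_) (sum-map-replicate g d x)

sum-map-parts-∷ : ∀ (g : ℕ → ℕ) d ds →
  sum (map g (parts (d ∷ ds))) ≡ d * g (2 ^ length ds) + sum (map g (parts ds))
sum-map-parts-∷ g d ds = begin
    sum (map g (replicate d (2 ^ length ds) ++ parts ds))
  ≡⟨ cong sum (map-++ g (replicate d (2 ^ length ds)) (parts ds)) ⟩
    sum (map g (replicate d (2 ^ length ds)) ++ map g (parts ds))
  ≡⟨ sum-++ (map g (replicate d (2 ^ length ds))) (map g (parts ds)) ⟩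
    sum (map g (replicate d (2 ^ length ds))) + sum (map g (parts ds))
  ≡⟨ cong (_+ sum (map g (parts ds))) (sum-map-replicate g d (2 ^ length ds)) ⟩
    d * g (2 ^ length ds) + sum (map g (parts ds))
  ∎
  where open ≡-Reasoning

prefix-suc-∷ : ∀ {k} d ds → k ≤ length ds → prefix (suc k) (d ∷ ds) ≡ d * 2 ^ k + prefix k ds
prefix-suc-∷ {k} d ds k≤ = cong (λ l → d * 2 ^ l + prefix k ds) (trans (length-take k ds) (m≤n⇒m⊓n≡m k≤))

prefix-∷-/2^ : ∀ e d ds →
  d * (2 ^ length ds /2^ e) + prefix (length ds ∸ e) ds ≡ prefix (suc (length ds) ∸ e) (d ∷ ds)
prefix-∷-/2^ e d ds with e ≤? length ds
... | yes e≤L = begin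
    d * (2 ^ L /2^ e) + prefix (L ∸ e) ds   ≡⟨ cong (λ q → d * q + prefix (L ∸ e) ds) (2^/2^ e≤L) ⟩
    d * 2 ^ (L ∸ e) + prefix (L ∸ e) ds     ≡⟨ sym (prefix-suc-∷ d ds (m∸n≤m L e)) ⟩
    prefix (suc (L ∸ e)) (d ∷ ds)           ≡⟨ cong (λ k → prefix k (d ∷ ds)) (sym (+-∸-assoc 1 e≤L)) ⟩
    prefix (suc L ∸ e) (d ∷ ds)             ∎
  where
  open ≡-Reasoning
  L = length ds
... | no e≰L = begin
    d * (2 ^ L /2^ e) + prefix (L ∸ e) ds   ≡⟨ cong₂ (λ q k → d * q + prefix k ds) (2^/2^-< L<e) (m≤n⇒m∸n≡0 (<⇒≤ L<e)) ⟩
    d * 0 + 0                               ≡⟨ trans (+-identityʳ (d * 0)) (*-zeroʳ d) ⟩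
    0                                       ≡⟨ cong (λ k → prefix k (d ∷ ds)) (sym (m≤n⇒m∸n≡0 L<e)) ⟩
    prefix (suc L ∸ e) (d ∷ ds)             ∎
  where
  open ≡-Reasoning
  L = length ds
  L<e = ≰⇒> e≰L

sum-parts-/2^ : ∀ e c → sum (map (_/2^ e) (parts c)) ≡ prefix (length c ∸ e) c
sum-parts-/2^ zero    []       = refl
sum-parts-/2^ (suc e) []       = refl
sum-parts-/2^ e       (d ∷ ds) = begin
    sum (map (_/2^ e) (parts (d ∷ ds)))                ≡⟨ sum-map-parts-∷ (_/2^ e) d ds ⟩
    d * (2 ^ L /2^ e) + sum (map (_/2^ e) (parts ds))  ≡⟨ cong (d * (2 ^ L /2^ e) +_) (sum-parts-/2^ e ds) ⟩
    d * (2 ^ L /2^ e) + prefix (L ∸ e) ds              ≡⟨ prefix-∷-/2^ e d ds ⟩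
    prefix (suc L ∸ e) (d ∷ ds)                        ∎
  where
  open ≡-Reasoning
  L = length ds

prefix-truncate : ∀ j c → prefix (length c ∸ (length c ∸ j)) c ≡ prefix j c
prefix-truncate j c with j ≤? length c
... | yes j≤k = cong (λ i → prefix i c) (m∸[m∸n]≡n j≤k)
... | no j≰k  = begin
    prefix (k ∸ (k ∸ j)) c  ≡⟨ cong (λ i → prefix (k ∸ i) c) (m≤n⇒m∸n≡0 k≤j) ⟩
    prefix k c              ≡⟨ cong value (trans (take-all k c ≤-refl) (sym (take-all j c k≤j))) ⟩
    prefix j c              ∎
  where
  open ≡-Reasoning
  k = length c
  k≤j = <⇒≤ (≰⇒> j≰k)

≼⇒prefix-≤ : ∀ {c c′} → length c ≡ length c′ → parts c ≼ parts c′ → ∀ j → prefix j c ≤ prefix j c′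
≼⇒prefix-≤ {c} {c′} |c|≡|c′| c≼c′ j = begin
    prefix j c                        ≡⟨ sym (prefix-truncate j c) ⟩
    prefix (k ∸ e) c                  ≡⟨ sym (sum-parts-/2^ e c) ⟩
    sum (map (_/2^ e) (parts c))      ≤⟨ ≼⇒sum-map-≤ (_/2^ e) (0/2^ e) /2^-superadditive {parts c} {parts c′} c≼c′ ⟩
    sum (map (_/2^ e) (parts c′))     ≡⟨ sum-parts-/2^ e c′ ⟩
    prefix (length c′ ∸ e) c′         ≡⟨ cong (λ l → prefix (length c′ ∸ (l ∸ j)) c′) |c|≡|c′| ⟩
    prefix (length c′ ∸ (length c′ ∸ j)) c′ ≡⟨ prefix-truncate j c′ ⟩
    prefix j c′                       ∎
  where
  open ≤-Reasoning
  k = length c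
  e = k ∸ j
  /2^-superadditive = /-superadditive (2 ^ e) {{m^n≢0 2 e}}

value-carry : ∀ d e h t → value ((d + e) ∷ h ∷ t) ≡ value (d ∷ (2 * e + h) ∷ t)
value-carry d e h t =
  solve 5 (λ d e h p v → (d :+ e) :* (con 2 :* p) :+ (h :* p :+ v) := d :* (con 2 :* p) :+ ((con 2 :* e :+ h) :* p :+ v))
        refl d e h (2 ^ length t) (value t)

value-∷-cancel : ∀ d xs ys → length xs ≡ length ys → value (d ∷ xs) ≡ value (d ∷ ys) → value xs ≡ value ys
value-∷-cancel d xs ys |xs|≡|ys| eq =
  +-cancelˡ-≡ (d * 2 ^ length xs) _ _ (trans eq (cong (λ l → d * 2 ^ l + value ys) (sym |xs|≡|ys|)))

prefix-∷-cancel : ∀ d j xs ys → length xs ≡ length ys →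
  prefix (suc j) (d ∷ xs) ≤ prefix (suc j) (d ∷ ys) → prefix j xs ≤ prefix j ys
prefix-∷-cancel d j xs ys |xs|≡|ys| le = +-cancelˡ-≤ (d * 2 ^ length (take j xs)) _ _
  (subst (λ l → _ ≤ d * 2 ^ l + prefix j ys) (sym (length-take-≡ j |xs|≡|ys|)) le)

prefix-≤⇒Blocks : ∀ c c′ → length c ≡ length c′ → value c ≡ value c′ →
  (∀ j → prefix j c ≤ prefix j c′) → Blocks (parts c) (parts c′)
prefix-≤⇒Blocks []       []        _ _ _ = []
prefix-≤⇒Blocks (d ∷ []) (d′ ∷ []) _ v _ =
  subst (λ x → Blocks (parts (d ∷ [])) (parts (x ∷ []))) (trans (sym (prefix-1 d [])) (trans v (prefix-1 d′ [])))
        (Blocks-refl _)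
prefix-≤⇒Blocks (d ∷ ds) (d′ ∷ h ∷ t) |c|≡|c′| v c≤c′
  with m≤n⇒∃[o]m+o≡n (subst₂ _≤_ (prefix-1 d ds) (prefix-1 d′ (h ∷ t)) (c≤c′ 1))
... | e , refl =
  Blocks-trans (Blocks-parts-∷ d ds ds′ |ds|≡ (prefix-≤⇒Blocks ds ds′ |ds|≡ v′ ds≤)) (parts-carry d e h t)
  where
  ds′ = (2 * e + h) ∷ t
  |ds|≡ : length ds ≡ length ds′
  |ds|≡ = suc-injective |c|≡|c′|
  v′ : value ds ≡ value ds′
  v′ = value-∷-cancel d ds ds′ |ds|≡ (trans v (value-carry d e h t))
  ds≤ : ∀ j → prefix j ds ≤ prefix j ds′
  ds≤ zero    = z≤n
  ds≤ (suc j) = prefix-∷-cancel d (suc j) ds ds′ |ds|≡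
    (subst (prefix (2 + j) (d ∷ ds) ≤_) (value-carry d e h (take j t)) (c≤c′ (2 + j)))

-- The minimum of 𝒟(n)

take-++ˡ : ∀ {j} (xs : List ℕ) {ys} → j ≤ length xs → take j (xs ++ ys) ≡ take j xs
take-++ˡ {zero}  xs       _         = refl
take-++ˡ {suc j} (x ∷ xs) (s≤s j≤) = cong (x ∷_) (take-++ˡ xs j≤)

value-map-suc : ∀ w → suc (value (map suc w)) ≡ value (1 ∷ w)
value-map-suc []      = refl
value-map-suc (x ∷ w) = begin
    suc (suc x * 2 ^ length (map suc w) + value (map suc w))
  ≡⟨ cong (λ l → suc (suc x * 2 ^ l + value (map suc w))) (length-map suc w) ⟩
    suc (suc x * P + value (map suc w))
  ≡⟨ sym (+-suc (suc x * P) (value (map suc w))) ⟩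
    suc x * P + suc (value (map suc w))
  ≡⟨ cong (suc x * P +_) (value-map-suc w) ⟩
    suc x * P + (1 * P + value w)
  ≡⟨ solve 3 (λ x p v → (con 1 :+ x) :* p :+ (con 1 :* p :+ v) := con 1 :* (con 2 :* p) :+ (x :* p :+ v)) refl x P (value w) ⟩
    1 * (2 * P) + (x * P + value w)
  ∎
  where
  open ≡-Reasoning
  P = 2 ^ length w

borrow : List ℕ → List ℕ → List ℕ
borrow w post = 0 ∷ map suc w ++ 2 ∷ post

length-borrow : ∀ w post → length (borrow w post) ≡ length (1 ∷ w ++ 0 ∷ post)
length-borrow w post = cong suc (begin
    length (map suc w ++ 2 ∷ post)        ≡⟨ length-++ (map suc w) ⟩
    length (map suc w) + length (2 ∷ post) ≡⟨ cong (_+ suc (length post)) (length-map suc w) ⟩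
    length w + length (0 ∷ post)           ≡⟨ sym (length-++ w) ⟩
    length (w ++ 0 ∷ post)                 ∎)
  where open ≡-Reasoning

borrow-≤2 : ∀ {w post} → All (_≤ 1) w → All (_≤ 2) post → All (_≤ 2) (borrow w post)
borrow-≤2 w≤1 post≤2 = z≤n ∷ Allₚ.++⁺ (Allₚ.map⁺ (All.map s≤s w≤1)) (≤-refl ∷ post≤2)

value-borrow : ∀ w post → value (borrow w post) ≡ value (1 ∷ w ++ 0 ∷ post)
value-borrow w post = begin
    value ((0 ∷ map suc w) ++ 2 ∷ post)
  ≡⟨ value-++ (0 ∷ map suc w) (2 ∷ post) ⟩
    value (map suc w) * (2 * P) + (2 * P + value post)
  ≡⟨ solve 3 (λ v p u → v :* (con 2 :* p) :+ (con 2 :* p :+ u) := (con 1 :+ v) :* (con 2 :* p) :+ u)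
           refl (value (map suc w)) P (value post) ⟩
    suc (value (map suc w)) * (2 * P) + value post
  ≡⟨ cong (λ v → v * (2 * P) + value post) (value-map-suc w) ⟩
    value (1 ∷ w) * (2 * P) + (0 * P + value post)
  ≡⟨ sym (value-++ (1 ∷ w) (0 ∷ post)) ⟩
    value (1 ∷ w ++ 0 ∷ post)
  ∎
  where
  open ≡-Reasoning
  P = 2 ^ length post

prefix-borrow : ∀ w post j → j ≤ length w →
  suc (prefix (suc j) (borrow w post)) ≡ prefix (suc j) (1 ∷ w ++ 0 ∷ post)
prefix-borrow w post j j≤ = begin
    suc (value (take j (map suc w ++ 2 ∷ post)))
  ≡⟨ cong (suc ∘ value) (trans (take-++ˡ (map suc w) (≤-trans j≤ (≤-reflexive (sym (length-map suc w))))) (take-map j w)) ⟩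
    suc (value (map suc (take j w)))
  ≡⟨ value-map-suc (take j w) ⟩
    value (1 ∷ take j w)
  ≡⟨ cong (λ xs → value (1 ∷ xs)) (sym (take-++ˡ w j≤)) ⟩
    value (1 ∷ take j (w ++ 0 ∷ post))
  ∎
  where open ≡-Reasoning

record Borrow (u : List ℕ) (ρ : ℕ) : Set where
  field
    lowered        : List ℕ
    lowered-length : length lowered ≡ length u
    lowered-≤2     : All (_≤ 2) lowered
    lowered-value  : value lowered ≡ value u
    lowered-prefix : ∀ j → j < ρ → suc (prefix (suc j) lowered) ≡ prefix (suc j) u

principal-borrow : ∀ {t} → All (_≤ 1) (1 ∷ t) → ∀ m → lastZero (1 ∷ t) ≡ m →
  Borrow (1 ∷ t) (fromMaybe 0 m)
principal-borrow {t} u≤1 nothing _ = record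
  { lowered        = 1 ∷ t
  ; lowered-length = refl
  ; lowered-≤2     = All.map m≤n⇒m≤1+n u≤1
  ; lowered-value  = refl
  ; lowered-prefix = λ _ ()
  }
principal-borrow {t} u≤1 (just i) eq with lastZero-just {1 ∷ t} eq
... | (_ ∷ w) , post , refl , refl , _ with Allₚ.++⁻ w (All.tail u≤1)
...   | w≤1 , _ ∷ post≤1 = record
  { lowered        = borrow w post
  ; lowered-length = length-borrow w post
  ; lowered-≤2     = borrow-≤2 w≤1 (All.map m≤n⇒m≤1+n post≤1)
  ; lowered-value  = value-borrow w post
  ; lowered-prefix = λ j j<r → prefix-borrow w post j (s≤s⁻¹ j<r)
  }

β-borrow : ∀ {n} → 1 ≤ n → Borrow (β n) (r n)
β-borrow {n} 1≤n with β-leading-one 1≤n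
... | t , β≡ = subst (λ u → Borrow u (fromMaybe 0 (lastZero u))) (sym β≡)
  (principal-borrow (subst (All (_≤ 1)) β≡ (β-binary n)) (lastZero (1 ∷ t)) refl)

-- The embedding s̃

[+1+m]-[+m]≡1 : ∀ m → ℤ.+ suc m - ℤ.+ m ≡ 1ℤ
[+1+m]-[+m]≡1 m =
  trans (ℤₚ.[+m]-[+n]≡m⊖n (suc m) m) (trans (ℤₚ.⊖-≥ (n≤1+n m)) (cong ℤ.+_ (m+n∸n≡m 1 m)))

i-k≤j-k⇒i≤j : ∀ {i j} k → i - k ≤ℤ j - k → i ≤ℤ j
i-k≤j-k⇒i≤j {i} {j} k le = subst₂ _≤ℤ_ (i-k+k≡i i) (i-k+k≡i j) (ℤₚ.+-monoˡ-≤ k le)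
  where
  i-k+k≡i : ∀ i → i - k ℤ.+ k ≡ i
  i-k+k≡i i =
    trans (ℤₚ.+-assoc i (ℤ.- k) k) (trans (cong (λ x → i ℤ.+ x) (ℤₚ.+-inverseˡ k)) (ℤₚ.+-identityʳ i))

m≤n≤1+m⇒n≡m∨n≡1+m : ∀ {m n} → m ≤ n → n ≤ suc m → n ≡ m ⊎ n ≡ suc m
m≤n≤1+m⇒n≡m∨n≡1+m m≤n n≤1+m with m≤n⇒m<n∨m≡n m≤n
... | inj₁ m<n = inj₂ (≤-antisym n≤1+m m<n)
... | inj₂ m≡n = inj₁ (sym m≡n)

module _ {n : ℕ} where

  word : HB n → List ℕ
  word = proj₁

  HB-value : ∀ (c : HB n) → value (word c) ≡ n
  HB-value (c , _ , _ , val≡n) = trans (sym (val≡value c)) val≡n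

  HB-digits : ∀ (c : HB n) → All (_≤ 2) (word c)
  HB-digits (_ , _ , c≤2 , _) = c≤2

  β-length : ∀ (c : HB n) → length (β n) ≡ length (word c)
  β-length (_ , |c|≡ , _) = sym |c|≡

  HB-length : ∀ (c c′ : HB n) → length (word c) ≡ length (word c′)
  HB-length c c′ = trans (sym (β-length c)) (β-length c′)

  module _ (c : HB n) where
    private
      |β|≡|c| = β-length c
      β≈c     = trans (value-β n) (sym (HB-value c))
      c≤2     = HB-digits c

    prefix-≤-β : ∀ j → prefix j (word c) ≤ prefix j (β n)
    prefix-≤-β = binary-prefix-≥ |β|≡|c| β≈c (β-binary n) c≤2

    β-prefix-≤suc : ∀ j → prefix j (β n) ≤ suc (prefix j (word c))
    β-prefix-≤suc = binary-prefix-≤suc |β|≡|c| β≈c (β-binary n) c≤2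

    prefix-beyond-r : ∀ j → suc (r n) ≤ j → prefix j (word c) ≡ prefix j (β n)
    prefix-beyond-r j r<j =
      sym (binary-prefix-≡ |β|≡|c| β≈c (β-binary n) c≤2 j (drop⁺-≤ (β n) r<j (β-ones-after-r n)))

  principal-prefix-≤ : ∀ (c c′ : HB n) →
    (∀ j → j < r n → prefix (suc j) (word c) ≤ prefix (suc j) (word c′)) →
    ∀ j → prefix j (word c) ≤ prefix j (word c′)
  principal-prefix-≤ c c′ ≤r zero    = z≤n
  principal-prefix-≤ c c′ ≤r (suc j) with j <? r n
  ... | yes j<r = ≤r j j<r
  ... | no  j≮r = ≤-reflexive (trans (prefix-beyond-r c _ r<) (sym (prefix-beyond-r c′ _ r<)))
    where r< = s≤s (≮⇒≥ j≮r)

  prefix-≤⇒≤D : ∀ (c c′ : HB n) → (∀ j → prefix j (word c) ≤ prefix j (word c′)) → c ≤D c′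
  prefix-≤⇒≤D c c′ =
    Blocks⇒≼ ∘ prefix-≤⇒Blocks (word c) (word c′) (HB-length c c′) (trans (HB-value c) (sym (HB-value c′)))

  ≤D⇒prefix-≤ : ∀ (c c′ : HB n) → c ≤D c′ → ∀ j → prefix j (word c) ≤ prefix j (word c′)
  ≤D⇒prefix-≤ c c′ = ≼⇒prefix-≤ (HB-length c c′)

  module _ (1≤n : 1 ≤ n) where
    private
      module B = Borrow (β-borrow 1≤n)

    z₀ : HB n
    z₀ = B.lowered , B.lowered-length , B.lowered-≤2 , trans (val≡value B.lowered) (trans B.lowered-value (value-β n))

    z₀-minimum : IsMinimum z₀
    z₀-minimum c = prefix-≤⇒≤D z₀ c (principal-prefix-≤ z₀ c λ j j<r →
      s≤s⁻¹ (subst (_≤ suc (prefix (suc j) (word c))) (sym (B.lowered-prefix j j<r)) (β-prefix-≤suc c (suc j))))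

    module _ (z : HB n) (z-min : IsMinimum z) where

      minimum-borrow : ∀ j → j < r n → suc (prefix (suc j) (word z)) ≡ prefix (suc j) (β n)
      minimum-borrow j j<r = ≤-antisym
        (≤-trans (s≤s (≤D⇒prefix-≤ z z₀ (z-min z₀) (suc j))) (≤-reflexive (B.lowered-prefix j j<r)))
        (β-prefix-≤suc z (suc j))

      ŝ : HB n → Fin (r n) → ℕ
      ŝ c j = prefix (suc (toℕ j)) (word c)

      s̃≡ : ∀ (c : HB n) j → s̃ z c j ≡ ℤ.+ ŝ c j - ℤ.+ ŝ z j
      s̃≡ c j = cong₂ (λ a b → ℤ.+ a - ℤ.+ b) (s≡prefix j′ (word c)) (s≡prefix j′ (word z))
        where j′ = suc (toℕ j)

      s̃≡0 : ∀ (c : HB n) j → ŝ c j ≡ ŝ z j → s̃ z c j ≡ 0ℤ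
      s̃≡0 c j eq = trans (s̃≡ c j) (trans (cong (λ a → ℤ.+ a - ℤ.+ ŝ z j) eq) (ℤₚ.+-inverseʳ (ℤ.+ ŝ z j)))

      s̃≡1 : ∀ (c : HB n) j → ŝ c j ≡ suc (ŝ z j) → s̃ z c j ≡ 1ℤ
      s̃≡1 c j eq = trans (s̃≡ c j) (trans (cong (λ a → ℤ.+ a - ℤ.+ ŝ z j) eq) ([+1+m]-[+m]≡1 (ŝ z j)))

      s̃-binary : ∀ (c : HB n) j → (s̃ z c j ≡ 0ℤ) ⊎ (s̃ z c j ≡ 1ℤ)
      s̃-binary c j = Sum.map (s̃≡0 c j) (s̃≡1 c j) (m≤n≤1+m⇒n≡m∨n≡1+m ŝz≤ ŝc≤)
        where
        ŝz≤ : ŝ z j ≤ ŝ c j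
        ŝz≤ = ≤D⇒prefix-≤ z c (z-min c) (suc (toℕ j))
        ŝc≤ : ŝ c j ≤ suc (ŝ z j)
        ŝc≤ = ≤-trans (prefix-≤-β c (suc (toℕ j))) (≤-reflexive (sym (minimum-borrow (toℕ j) (toℕ<n j))))

      s̃-≤⇒prefix-≤ : ∀ (c c′ : HB n) → (∀ j → s̃ z c j ≤ℤ s̃ z c′ j) →
        ∀ j → prefix j (word c) ≤ prefix j (word c′)
      s̃-≤⇒prefix-≤ c c′ s̃≤ = principal-prefix-≤ c c′ λ j j<r →
        subst (λ i → prefix (suc i) (word c) ≤ prefix (suc i) (word c′)) (toℕ-fromℕ< j<r) (ŝ-≤ (fromℕ< j<r))
        where
        ŝ-≤ : ∀ j → ŝ c j ≤ ŝ c′ j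
        ŝ-≤ j = ℤₚ.drop‿+≤+ (i-k≤j-k⇒i≤j (ℤ.+ ŝ z j) (subst₂ _≤ℤ_ (s̃≡ c j) (s̃≡ c′ j) (s̃≤ j)))

      ≤D⇔s̃-≤ : ∀ (c c′ : HB n) → (c ≤D c′) ⇔ (∀ j → s̃ z c j ≤ℤ s̃ z c′ j)
      ≤D⇔s̃-≤ c c′ = mk⇔
        (λ c≤c′ j → subst₂ _≤ℤ_ (sym (s̃≡ c j)) (sym (s̃≡ c′ j))
          (ℤₚ.+-monoˡ-≤ (ℤ.- ℤ.+ ŝ z j) (+≤+ (≤D⇒prefix-≤ c c′ c≤c′ (suc (toℕ j))))))
        (prefix-≤⇒≤D c c′ ∘ s̃-≤⇒prefix-≤ c c′)

      s̃-injective : ∀ (c c′ : HB n) → (∀ j → s̃ z c j ≡ s̃ z c′ j) → word c ≡ word c′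
      s̃-injective c c′ s̃≡s̃ = prefix-injective (HB-length c c′) λ j → ≤-antisym
        (s̃-≤⇒prefix-≤ c c′ (ℤₚ.≤-reflexive ∘ s̃≡s̃) j)
        (s̃-≤⇒prefix-≤ c′ c (ℤₚ.≤-reflexive ∘ sym ∘ s̃≡s̃) j)

      s̃-β : ∀ (c : HB n) → word c ≡ β n → ∀ j → s̃ z c j ≡ 1ℤ
      s̃-β c c≡β j =
        s̃≡1 c j (trans (cong (prefix (suc (toℕ j))) c≡β) (sym (minimum-borrow (toℕ j) (toℕ<n j))))

  s̃-self : ∀ (z : HB n) j → s̃ z z j ≡ 0ℤ
  s̃-self z j = ℤₚ.+-inverseʳ (ℤ.+ s (suc (toℕ j)) (word z))

proposition3p9 : (n : ℕ) → 1 ≤ n →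
    (∃ λ (z : HB n) → IsMinimum z) ×
    ((z : HB n) → IsMinimum z →
      ((c : HB n) (j : Fin (r n)) → (s̃ z c j ≡ 0ℤ) ⊎ (s̃ z c j ≡ 1ℤ))
      × ((c c' : HB n) → (c ≤D c') ⇔ ((j : Fin (r n)) → s̃ z c j ≤ℤ s̃ z c' j))
      × ((c c' : HB n) → ((j : Fin (r n)) → s̃ z c j ≡ s̃ z c' j) → proj₁ c ≡ proj₁ c')
      × ((j : Fin (r n)) → s̃ z z j ≡ 0ℤ)
      × ((c : HB n) → proj₁ c ≡ β n → (j : Fin (r n)) → s̃ z c j ≡ 1ℤ))
proposition3p9 n 1≤n =
  (z₀ 1≤n , z₀-minimum 1≤n) ,
  λ z z-min → s̃-binary 1≤n z z-min , ≤D⇔s̃-≤ 1≤n z z-min , s̃-injective 1≤n z z-min , s̃-self z , s̃-β 1≤n z z-min
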